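{- Let $p\ge 3$ be a prime and, for each nonzero integer $m$, define integers $d_m(n)$ by $$\frac{1}{(1-x)^{m}}\prod_{i=0}^{\infty}\frac{1}{(1-x^{p^{i}})^{(p-1)m}}=\sum_{n=0}^{\infty}d_{m}(n)x^{n}.$$ Let $m\ge 1$ be an integer. Then for every integer $n\ge 1$, $$d_{ -m}(n)\equiv -d_m(n)\pmod{p^{\nu_p(m)+2}},$$ and in particular $$d_{ -m}(pn)\equiv d_{ -m}(n)\pmod{p^{\nu_p(m)+2}}.$$
   Context: $\nu_p(a)$ denotes the $p$-adic valuation of the integer $a$. -}

module Defs where

open import Data.Nat as ℕ using (ℕ; zero; suc; _≡ᵇ_)
open import Data.Nat.Divisibility as ℕD using (_∣?_; quotient)
open import Data.Integer as ℤ using (ℤ; +_; -[1+_]; -_)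
open import Data.Bool using (if_then_else_)
open import Relation.Nullary using (yes; no)

Series : Set
Series = ℕ → ℤ

sumTo : ℕ → (ℕ → ℤ) → ℤ
sumTo zero    f = f zero
sumTo (suc n) f = sumTo n f ℤ.+ f (suc n)

_⊛_ : Series → Series → Series
(f ⊛ g) n = sumTo n (λ k → f k ℤ.* g (n ℕ.∸ k))

oneS : Series
oneS zero    = + 1
oneS (suc _) = + 0

-- 1/(1-x) = 1 + x + x^2 + ...
geomS : Series
geomS _ = + 1

oneMinusX : Series
oneMinusX zero          = + 1
oneMinusX (suc zero)    = -[1+ 0 ]
oneMinusX (suc (suc _)) = + 0

powS : Series → ℕ → Series
powS f zero    = oneS
powS f (suc k) = f ⊛ powS f k

-- (1-x)^{-e} for an integer exponent e
invPow : ℤ → Series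
invPow (+ k)     = powS geomS k
invPow -[1+ k ]  = powS oneMinusX (suc k)

-- substitution x ↦ x^a (for a ≥ 1): coefficient of x^n is f(n/a) if a ∣ n, else 0
dilate : ℕ → Series → Series
dilate a f n = sumTo n (λ k → if (k ℕ.* a) ≡ᵇ n then f k else + 0)

prodS : ℕ → (ℕ → Series) → Series
prodS zero    F = oneS
prodS (suc N) F = prodS N F ⊛ F N

-- Factors with p^i > n are ≡ 1 mod x^{n+1}; since p^i > n for i ≥ n+1 (p ≥ 2),
-- truncating the product at i ≤ n does not change the coefficient of x^n.
d : ℕ → ℤ → ℕ → ℤ
d p m n =
  (invPow m ⊛ prodS (suc n) (λ i → dilate (p ℕ.^ i) (invPow (+ (p ℕ.∸ 1) ℤ.* m)))) n

-- p-adic valuation of a natural number (fuel = m suffices for p ≥ 2, m ≥ 1)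
νgo : ℕ → ℕ → ℕ → ℕ
νgo p zero     m = 0
νgo p (suc f)  zero = 0
νgo p (suc f)  (suc m) with p ∣? suc m
... | yes pm = suc (νgo p f (quotient pm))
... | no  _  = 0

ν : ℕ → ℕ → ℕ
ν p m = νgo p m m

-- Write F = (1 - x)⁻¹ ∏ᵢ (1 - x^(pⁱ))^-(p-1) and G = F⁻¹, so that Σ dₘ(n) xⁿ = Fᵐ and Σ d₋ₘ(n) xⁿ = Gᵐ.
-- Since (1 - x)ᵖ ≡ 1 - xᵖ (mod p), the product G telescopes modulo p, and G ≡ F ≡ 1 (mod p) in low degrees.
-- For odd p, H ≡ 1 (mod p) implies Hᵐ ≡ 1 + m (H - 1) (mod p^(ν(m)+2)); so Fᵐ ≡ Gᵐ ≡ 1 (mod p^(ν(m)+1)),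
-- and 2 - Fᵐ - Gᵐ = (Fᵐ - 1)(Gᵐ - 1) ≡ 0 (mod p^(ν(m)+2)).
-- Moreover G = w · G(xᵖ) with w = (1 - x)ᵖ / (1 - xᵖ) ≡ 1 (mod p), and the coefficients of w at multiples
-- of p are those of 1. Hence so are those of wᵐ ≡ 1 + m (w - 1) modulo p^(ν(m)+2), and the coefficient
-- of x^(pn) in Gᵐ = wᵐ Gᵐ(xᵖ) is congruent to that of xⁿ in Gᵐ.

module Submission where

open import Defs
open import Data.Nat as ℕ using (ℕ; zero; suc; z≤n; s≤s; NonZero; _≡ᵇ_; _≤_; _<_; _^_; _+_; _*_; _∸_)
import Data.Nat.Properties as ℕ
import Data.Nat.Divisibility as ℕ
open import Data.Nat.Primality using (Prime; euclidsLemma; prime⇒irreducible)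
open import Data.Nat.Combinatorics using (_C_; nC1≡n; nCn≡1; k>n⇒nCk≡0; nCk+nC[k+1]≡[n+1]C[k+1])
open import Data.Integer as ℤ using (ℤ; +_; -[1+_]; -_)
import Data.Integer.Properties as ℤ
open import Data.Integer.Divisibility using (_∣_)
open import Data.Integer.Divisibility.Signed as ℤ∣ using (divides)
open import Data.Integer.Tactic.RingSolver using (solve-∀)
open import Data.Nat.Tactic.RingSolver using () renaming (solve-∀ to solveℕ)
open import Data.Product using (_×_; _,_)
open import Data.Sum using (_⊎_; inj₁; inj₂)
open import Data.Maybe using (Maybe; just; nothing)
open import Data.Empty using (⊥-elim)
open import Relation.Nullary using (¬_; Dec; yes; no)
open import Relation.Binary.Definitions using (tri<; tri≈; tri>)
open import Data.Bool using (T; true; false; if_then_else_)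
open import Relation.Binary.PropositionalEquality
open import Function using (_∘_)
open import Algebra.Bundles using (CommutativeRing)
import Relation.Binary.Reasoning.Setoid as SetoidReasoning
open import Algebra.Solver.Ring.AlmostCommutativeRing
  using (AlmostCommutativeRing; fromCommutativeRing; _-Raw-AlmostCommutative⟶_)

-- Finite sums

sumTo-cong : ∀ n {f g : ℕ → ℤ} → (∀ k → k ≤ n → f k ≡ g k) → sumTo n f ≡ sumTo n g
sumTo-cong zero    f≡g = f≡g 0 z≤n
sumTo-cong (suc n) f≡g =
  cong₂ ℤ._+_ (sumTo-cong n λ k k≤n → f≡g k (ℕ.m≤n⇒m≤1+n k≤n)) (f≡g (suc n) ℕ.≤-refl)

sumTo-unfoldˡ : ∀ n (f : ℕ → ℤ) → sumTo (suc n) f ≡ f 0 ℤ.+ sumTo n (λ k → f (suc k))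
sumTo-unfoldˡ zero    f = refl
sumTo-unfoldˡ (suc n) f = begin
  sumTo (suc n) f ℤ.+ f (suc (suc n))                      ≡⟨ cong (ℤ._+ f (suc (suc n))) (sumTo-unfoldˡ n f) ⟩
  (f 0 ℤ.+ sumTo n (λ k → f (suc k))) ℤ.+ f (suc (suc n))  ≡⟨ ℤ.+-assoc (f 0) _ _ ⟩
  f 0 ℤ.+ sumTo (suc n) (λ k → f (suc k))                  ∎
  where open ≡-Reasoning

sumTo-distrib-+ : ∀ n (f g : ℕ → ℤ) → sumTo n (λ k → f k ℤ.+ g k) ≡ sumTo n f ℤ.+ sumTo n g
sumTo-distrib-+ zero    f g = refl
sumTo-distrib-+ (suc n) f g = begin
  sumTo n (λ k → f k ℤ.+ g k) ℤ.+ (f (suc n) ℤ.+ g (suc n))  ≡⟨ cong (ℤ._+ (f (suc n) ℤ.+ g (suc n))) (sumTo-distrib-+ n f g) ⟩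
  (sumTo n f ℤ.+ sumTo n g) ℤ.+ (f (suc n) ℤ.+ g (suc n))    ≡⟨ interchange (sumTo n f) (sumTo n g) (f (suc n)) (g (suc n)) ⟩
  (sumTo n f ℤ.+ f (suc n)) ℤ.+ (sumTo n g ℤ.+ g (suc n))    ∎
  where
  open ≡-Reasoning
  interchange : ∀ a b c d → (a ℤ.+ b) ℤ.+ (c ℤ.+ d) ≡ (a ℤ.+ c) ℤ.+ (b ℤ.+ d)
  interchange = solve-∀

sumTo-*ˡ : ∀ n c (f : ℕ → ℤ) → sumTo n (λ k → c ℤ.* f k) ≡ c ℤ.* sumTo n f
sumTo-*ˡ zero    c f = refl
sumTo-*ˡ (suc n) c f = trans (cong (ℤ._+ c ℤ.* f (suc n)) (sumTo-*ˡ n c f)) (sym (ℤ.*-distribˡ-+ c _ _))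

sumTo-neg : ∀ n (f : ℕ → ℤ) → sumTo n (λ k → - f k) ≡ - sumTo n f
sumTo-neg zero    f = refl
sumTo-neg (suc n) f = trans (cong (ℤ._+ - f (suc n)) (sumTo-neg n f)) (sym (ℤ.neg-distrib-+ (sumTo n f) _))

∣-sumTo : ∀ n {c} (f : ℕ → ℤ) → (∀ k → k ≤ n → c ℤ∣.∣ f k) → c ℤ∣.∣ sumTo n f
∣-sumTo zero    f c∣f = c∣f 0 z≤n
∣-sumTo (suc n) f c∣f =
  ℤ∣.∣m∣n⇒∣m+n (∣-sumTo n f λ k k≤n → c∣f k (ℕ.m≤n⇒m≤1+n k≤n)) (c∣f (suc n) ℕ.≤-refl)

sumTo-zero : ∀ n (f : ℕ → ℤ) → (∀ k → k ≤ n → f k ≡ + 0) → sumTo n f ≡ + 0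
sumTo-zero zero    f f≡0 = f≡0 0 z≤n
sumTo-zero (suc n) f f≡0 =
  cong₂ ℤ._+_ (sumTo-zero n f λ k k≤n → f≡0 k (ℕ.m≤n⇒m≤1+n k≤n)) (f≡0 (suc n) ℕ.≤-refl)

sumTo-single : ∀ n q (f : ℕ → ℤ) → q ≤ n → (∀ k → k ≤ n → k ≢ q → f k ≡ + 0) → sumTo n f ≡ f q
sumTo-single zero    .zero f z≤n _ = refl
sumTo-single (suc n) q f q≤n f≡0 with q ℕ.≟ suc n
... | yes refl = trans (cong (ℤ._+ f (suc n)) (sumTo-zero n f λ k k≤n → f≡0 k (ℕ.m≤n⇒m≤1+n k≤n) (ℕ.<⇒≢ (s≤s k≤n))))
                       (ℤ.+-identityˡ _)
... | no  q≢n  = trans (cong₂ ℤ._+_ (sumTo-single n q f (ℕ.≤-pred (ℕ.≤∧≢⇒< q≤n q≢n)) λ k k≤n → f≡0 k (ℕ.m≤n⇒m≤1+n k≤n))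
                                  (f≡0 (suc n) ℕ.≤-refl (q≢n ∘ sym)))
                       (ℤ.+-identityʳ _)

sumTo-reverse : ∀ n (f : ℕ → ℤ) → sumTo n f ≡ sumTo n (λ k → f (n ∸ k))
sumTo-reverse zero    f = refl
sumTo-reverse (suc n) f = begin
  sumTo n f ℤ.+ f (suc n)                  ≡⟨ cong (ℤ._+ f (suc n)) (sumTo-reverse n f) ⟩
  sumTo n (λ k → f (n ∸ k)) ℤ.+ f (suc n)  ≡⟨ ℤ.+-comm _ (f (suc n)) ⟩
  f (suc n) ℤ.+ sumTo n (λ k → f (n ∸ k))  ≡⟨ sumTo-unfoldˡ n (λ k → f (suc n ∸ k)) ⟨
  sumTo (suc n) (λ k → f (suc n ∸ k))      ∎
  where open ≡-Reasoning

sumTo-split : ∀ n t (f : ℕ → ℤ) → sumTo (n + suc t) f ≡ sumTo n f ℤ.+ sumTo t (λ i → f (n + suc i))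
sumTo-split n zero f = trans (cong (λ z → sumTo z f) (ℕ.+-comm n 1)) (cong (λ z → sumTo n f ℤ.+ f z) (ℕ.+-comm 1 n))
sumTo-split n (suc t) f = begin
  sumTo (n + suc (suc t)) f                                              ≡⟨ cong (λ z → sumTo z f) (ℕ.+-suc n (suc t)) ⟩
  sumTo (n + suc t) f ℤ.+ f (suc (n + suc t))                            ≡⟨ cong₂ ℤ._+_ (sumTo-split n t f) (cong f (sym (ℕ.+-suc n (suc t)))) ⟩
  (sumTo n f ℤ.+ sumTo t (λ i → f (n + suc i))) ℤ.+ f (n + suc (suc t))  ≡⟨ ℤ.+-assoc (sumTo n f) _ _ ⟩
  sumTo n f ℤ.+ sumTo (suc t) (λ i → f (n + suc i))                      ∎
  where open ≡-Reasoning

-- The ring of power series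

infix 4 _≈_
record _≈_ (f g : Series) : Set where
  constructor coeffwise
  field coeff : ∀ n → f n ≡ g n
open _≈_ public

infixl 6 _⊕_ _⊖_
infix 8 ⊝_

_⊕_ : Series → Series → Series
(f ⊕ g) n = f n ℤ.+ g n

⊝_ : Series → Series
(⊝ f) n = - f n

_⊖_ : Series → Series → Series
f ⊖ g = f ⊕ ⊝ g

zeroS : Series
zeroS _ = + 0

scale : ℤ → Series → Series
scale c f n = c ℤ.* f n

shift : Series → Series
shift f n = f (suc n)

⊛-unfold : ∀ f g n → (f ⊛ g) (suc n) ≡ f 0 ℤ.* g (suc n) ℤ.+ (shift f ⊛ g) n
⊛-unfold f g n = sumTo-unfoldˡ n (λ k → f k ℤ.* g (suc n ∸ k))

⊛-cong : ∀ {f f′ g g′} → f ≈ f′ → g ≈ g′ → f ⊛ g ≈ f′ ⊛ g′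
⊛-cong f≈f′ g≈g′ = coeffwise λ n → sumTo-cong n λ k _ → cong₂ ℤ._*_ (coeff f≈f′ k) (coeff g≈g′ (n ∸ k))

⊛-comm : ∀ f g → f ⊛ g ≈ g ⊛ f
⊛-comm f g = coeffwise λ n → begin
  sumTo n (λ k → f k ℤ.* g (n ∸ k))              ≡⟨ sumTo-reverse n _ ⟩
  sumTo n (λ k → f (n ∸ k) ℤ.* g (n ∸ (n ∸ k)))  ≡⟨ sumTo-cong n swap ⟩
  sumTo n (λ k → g k ℤ.* f (n ∸ k))              ∎
  where
  open ≡-Reasoning
  swap : ∀ {n} k → k ≤ n → f (n ∸ k) ℤ.* g (n ∸ (n ∸ k)) ≡ g k ℤ.* f (n ∸ k)
  swap {n} k k≤n = trans (cong (λ j → f (n ∸ k) ℤ.* g j) (ℕ.m∸[m∸n]≡n k≤n)) (ℤ.*-comm (f (n ∸ k)) (g k))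

⊛-distribˡ : ∀ f g h → f ⊛ (g ⊕ h) ≈ (f ⊛ g) ⊕ (f ⊛ h)
⊛-distribˡ f g h = coeffwise λ n → trans (sumTo-cong n λ k _ → ℤ.*-distribˡ-+ (f k) _ _) (sumTo-distrib-+ n _ _)

⊛-distribʳ : ∀ f g h → (g ⊕ h) ⊛ f ≈ (g ⊛ f) ⊕ (h ⊛ f)
⊛-distribʳ f g h = coeffwise λ n →
  trans (coeff (⊛-comm (g ⊕ h) f) n)
        (trans (coeff (⊛-distribˡ f g h) n) (cong₂ ℤ._+_ (coeff (⊛-comm f g) n) (coeff (⊛-comm f h) n)))

scale-⊛ : ∀ c f g → scale c f ⊛ g ≈ scale c (f ⊛ g)
scale-⊛ c f g = coeffwise λ n → trans (sumTo-cong n λ k _ → ℤ.*-assoc c (f k) _) (sumTo-*ˡ n c _)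

⊛-identityˡ : ∀ f → oneS ⊛ f ≈ f
⊛-identityˡ f = coeffwise λ n → trans (sumTo-single n 0 _ z≤n off-zero) (ℤ.*-identityˡ (f n))
  where
  off-zero : ∀ {n} k → k ≤ n → k ≢ 0 → oneS k ℤ.* f (n ∸ k) ≡ + 0
  off-zero zero    _ k≢0 = ⊥-elim (k≢0 refl)
  off-zero (suc k) _ _   = refl

⊛-identityʳ : ∀ f → f ⊛ oneS ≈ f
⊛-identityʳ f = coeffwise λ n → trans (coeff (⊛-comm f oneS) n) (coeff (⊛-identityˡ f) n)

⊛-assoc : ∀ f g h → (f ⊛ g) ⊛ h ≈ f ⊛ (g ⊛ h)
⊛-assoc f g h = coeffwise (go f g)
  where
  go : ∀ f g n → ((f ⊛ g) ⊛ h) n ≡ (f ⊛ (g ⊛ h)) n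
  go f g zero    = ℤ.*-assoc (f 0) (g 0) (h 0)
  go f g (suc n) = begin
    ((f ⊛ g) ⊛ h) (suc n)                                ≡⟨ ⊛-unfold (f ⊛ g) h n ⟩
    f 0 ℤ.* g 0 ℤ.* h (suc n) ℤ.+ (shift (f ⊛ g) ⊛ h) n  ≡⟨ cong (λ z → f 0 ℤ.* g 0 ℤ.* h (suc n) ℤ.+ z) shift-f⊛g⊛h ⟩
    f 0 ℤ.* g 0 ℤ.* h (suc n) ℤ.+ (f 0 ℤ.* (shift g ⊛ h) n ℤ.+ (shift f ⊛ (g ⊛ h)) n)
                                                         ≡⟨ regroup (f 0) (g 0) (h (suc n)) _ _ ⟩
    f 0 ℤ.* (g 0 ℤ.* h (suc n) ℤ.+ (shift g ⊛ h) n) ℤ.+ (shift f ⊛ (g ⊛ h)) n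
                                                         ≡⟨ cong (λ z → f 0 ℤ.* z ℤ.+ (shift f ⊛ (g ⊛ h)) n) (⊛-unfold g h n) ⟨
    f 0 ℤ.* (g ⊛ h) (suc n) ℤ.+ (shift f ⊛ (g ⊛ h)) n    ≡⟨ ⊛-unfold f (g ⊛ h) n ⟨
    (f ⊛ (g ⊛ h)) (suc n)                                ∎
    where
    open ≡-Reasoning
    regroup : ∀ a b c x y → a ℤ.* b ℤ.* c ℤ.+ (a ℤ.* x ℤ.+ y) ≡ a ℤ.* (b ℤ.* c ℤ.+ x) ℤ.+ y
    regroup = solve-∀
    shift-f⊛g⊛h : (shift (f ⊛ g) ⊛ h) n ≡ f 0 ℤ.* (shift g ⊛ h) n ℤ.+ (shift f ⊛ (g ⊛ h)) n
    shift-f⊛g⊛h = begin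
      (shift (f ⊛ g) ⊛ h) n                                    ≡⟨ coeff (⊛-cong {g = h} (coeffwise (⊛-unfold f g)) (coeffwise λ _ → refl)) n ⟩
      ((scale (f 0) (shift g) ⊕ (shift f ⊛ g)) ⊛ h) n          ≡⟨ coeff (⊛-distribʳ h (scale (f 0) (shift g)) (shift f ⊛ g)) n ⟩
      (scale (f 0) (shift g) ⊛ h) n ℤ.+ ((shift f ⊛ g) ⊛ h) n  ≡⟨ cong₂ ℤ._+_ (coeff (scale-⊛ (f 0) (shift g) h) n) (go (shift f) g n) ⟩
      f 0 ℤ.* (shift g ⊛ h) n ℤ.+ (shift f ⊛ (g ⊛ h)) n        ∎

seriesRing : CommutativeRing _ _
seriesRing = record
  { Carrier = Series ; _≈_ = _≈_ ; _+_ = _⊕_ ; _*_ = _⊛_ ; -_ = ⊝_ ; 0# = zeroS ; 1# = oneS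
  ; isCommutativeRing = record
    { isRing = record
      { +-isAbelianGroup = record
        { isGroup = record
          { isMonoid = record
            { isSemigroup = record
              { isMagma = record
                { isEquivalence = record
                  { refl  = coeffwise λ _ → refl
                  ; sym   = λ f≈g → coeffwise λ n → sym (coeff f≈g n)
                  ; trans = λ f≈g g≈h → coeffwise λ n → trans (coeff f≈g n) (coeff g≈h n) }
                ; ∙-cong = λ f≈f′ g≈g′ → coeffwise λ n → cong₂ ℤ._+_ (coeff f≈f′ n) (coeff g≈g′ n) }
              ; assoc = λ f g h → coeffwise λ n → ℤ.+-assoc (f n) (g n) (h n) }
            ; identity = (λ f → coeffwise λ n → ℤ.+-identityˡ (f n)) , (λ f → coeffwise λ n → ℤ.+-identityʳ (f n)) }
          ; inverse = (λ f → coeffwise λ n → ℤ.+-inverseˡ (f n)) , (λ f → coeffwise λ n → ℤ.+-inverseʳ (f n))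
          ; ⁻¹-cong = λ f≈g → coeffwise λ n → cong -_ (coeff f≈g n) }
        ; comm = λ f g → coeffwise λ n → ℤ.+-comm (f n) (g n) }
      ; *-cong = ⊛-cong
      ; *-assoc = ⊛-assoc
      ; *-identity = ⊛-identityˡ , ⊛-identityʳ
      ; distrib = ⊛-distribˡ , ⊛-distribʳ }
    ; *-comm = ⊛-comm } }

open CommutativeRing seriesRing public
  using (+-cong; -‿cong)
  renaming (zeroʳ to ⊛-zeroʳ; setoid to seriesSetoid; refl to ≈-refl; sym to ≈-sym; trans to ≈-trans; reflexive to ≈-reflexive)

module ≈-Reasoning = SetoidReasoning seriesSetoid

⊛-congˡ : ∀ f {g h} → g ≈ h → f ⊛ g ≈ f ⊛ h
⊛-congˡ f = ⊛-cong (≈-refl {f})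

⊛-congʳ : ∀ h {f g} → f ≈ g → f ⊛ h ≈ g ⊛ h
⊛-congʳ h f≈g = ⊛-cong f≈g (≈-refl {h})

-- 0 and 1 are sent to zeroS and oneS on the nose, so that the solver's terms match the series in goals.
constant : ℤ → Series
constant (+ 0) = zeroS
constant (+ 1) = oneS
constant c     = scale c oneS

constant≈scale : ∀ c → constant c ≈ scale c oneS
constant≈scale (+ 0)           = coeffwise λ _ → refl
constant≈scale (+ 1)           = coeffwise λ n → sym (ℤ.*-identityˡ (oneS n))
constant≈scale (+ suc (suc _)) = ≈-refl
constant≈scale -[1+ _ ]        = ≈-refl

scale-one-* : ∀ a b → scale (a ℤ.* b) oneS ≈ scale a oneS ⊛ scale b oneS
scale-one-* a b = coeffwise λ n → begin
  a ℤ.* b ℤ.* oneS n               ≡⟨ ℤ.*-assoc a b (oneS n) ⟩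
  a ℤ.* (b ℤ.* oneS n)             ≡⟨ cong (a ℤ.*_) (coeff (⊛-identityˡ (scale b oneS)) n) ⟨
  a ℤ.* (oneS ⊛ scale b oneS) n    ≡⟨ coeff (scale-⊛ a oneS (scale b oneS)) n ⟨
  (scale a oneS ⊛ scale b oneS) n  ∎
  where open ≡-Reasoning

private
  seriesACR : AlmostCommutativeRing _ _
  seriesACR = fromCommutativeRing seriesRing

  constant-morphism : ℤ.+-*-rawRing -Raw-AlmostCommutative⟶ seriesACR
  constant-morphism = record
    { ⟦_⟧    = constant
    ; +-homo = λ a b → ≈-trans (constant≈scale (a ℤ.+ b))
                 (coeffwise λ n → trans (ℤ.*-distribʳ-+ (oneS n) a b)
                                        (sym (cong₂ ℤ._+_ (coeff (constant≈scale a) n) (coeff (constant≈scale b) n))))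
    ; *-homo = λ a b → ≈-trans (constant≈scale (a ℤ.* b))
                 (≈-trans (scale-one-* a b) (⊛-cong (≈-sym (constant≈scale a)) (≈-sym (constant≈scale b))))
    ; -‿homo = λ a → ≈-trans (constant≈scale (- a))
                 (coeffwise λ n → trans (sym (ℤ.neg-distribˡ-* a (oneS n))) (cong -_ (sym (coeff (constant≈scale a) n))))
    ; 0-homo = ≈-refl
    ; 1-homo = ≈-refl
    }

  constant-≟ : ∀ a b → Maybe (constant a ≈ constant b)
  constant-≟ a b with a ℤ.≟ b
  ... | yes refl = just ≈-refl
  ... | no  _    = nothing

open import Algebra.Solver.Ring ℤ.+-*-rawRing seriesACR constant-morphism constant-≟
  using (solve; _:=_; _:+_; _:*_; _:-_; con)

⊛-interchange : ∀ a b c d → (a ⊛ b) ⊛ (c ⊛ d) ≈ (a ⊛ c) ⊛ (b ⊛ d)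
⊛-interchange = solve 4 (λ a b c d → (a :* b) :* (c :* d) := (a :* c) :* (b :* d)) ≈-refl

powS-cong : ∀ {f g} k → f ≈ g → powS f k ≈ powS g k
powS-cong zero    f≈g = ≈-refl
powS-cong (suc k) f≈g = ⊛-cong f≈g (powS-cong k f≈g)

powS-oneS : ∀ k → powS oneS k ≈ oneS
powS-oneS zero    = ≈-refl
powS-oneS (suc k) = ≈-trans (⊛-identityˡ (powS oneS k)) (powS-oneS k)

powS-distrib-⊛ : ∀ f g k → powS (f ⊛ g) k ≈ powS f k ⊛ powS g k
powS-distrib-⊛ f g zero    = ≈-sym (⊛-identityˡ oneS)
powS-distrib-⊛ f g (suc k) = ≈-trans (⊛-congˡ (f ⊛ g) (powS-distrib-⊛ f g k)) (⊛-interchange f g (powS f k) (powS g k))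

powS-+ : ∀ f a b → powS f (a + b) ≈ powS f a ⊛ powS f b
powS-+ f zero    b = ≈-sym (⊛-identityˡ (powS f b))
powS-+ f (suc a) b = ≈-trans (⊛-congˡ f (powS-+ f a b)) (≈-sym (⊛-assoc f (powS f a) (powS f b)))

powS-* : ∀ f a b → powS f (a * b) ≈ powS (powS f a) b
powS-* f zero    b = ≈-sym (powS-oneS b)
powS-* f (suc a) b =
  ≈-trans (powS-+ f b (a * b)) (≈-trans (⊛-congˡ (powS f b) (powS-* f a b)) (≈-sym (powS-distrib-⊛ f (powS f a) b)))

prodS-cong : ∀ K {φ ψ} → (∀ i → φ i ≈ ψ i) → prodS K φ ≈ prodS K ψ
prodS-cong zero    φ≈ψ = ≈-refl
prodS-cong (suc K) φ≈ψ = ⊛-cong (prodS-cong K φ≈ψ) (φ≈ψ K)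

prodS-distrib-⊛ : ∀ K φ ψ → prodS K (λ i → φ i ⊛ ψ i) ≈ prodS K φ ⊛ prodS K ψ
prodS-distrib-⊛ zero    φ ψ = ≈-sym (⊛-identityˡ oneS)
prodS-distrib-⊛ (suc K) φ ψ =
  ≈-trans (⊛-congʳ (φ K ⊛ ψ K) (prodS-distrib-⊛ K φ ψ)) (⊛-interchange (prodS K φ) (prodS K ψ) (φ K) (ψ K))

prodS-powS : ∀ K φ m → prodS K (λ i → powS (φ i) m) ≈ powS (prodS K φ) m
prodS-powS zero    φ m = ≈-sym (powS-oneS m)
prodS-powS (suc K) φ m = ≈-trans (⊛-congʳ (powS (φ K) m) (prodS-powS K φ m)) (≈-sym (powS-distrib-⊛ (prodS K φ) (φ K) m))

prodS-oneS : ∀ K φ → (∀ i → φ i ≈ oneS) → prodS K φ ≈ oneS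
prodS-oneS zero    φ φ≈1 = ≈-refl
prodS-oneS (suc K) φ φ≈1 = ≈-trans (⊛-cong (prodS-oneS K φ φ≈1) (φ≈1 K)) (⊛-identityˡ oneS)

prodS-unfoldˡ : ∀ K φ → prodS (suc K) φ ≈ φ 0 ⊛ prodS K (λ i → φ (suc i))
prodS-unfoldˡ zero    φ = ≈-trans (⊛-identityˡ (φ 0)) (≈-sym (⊛-identityʳ (φ 0)))
prodS-unfoldˡ (suc K) φ =
  ≈-trans (⊛-congʳ (φ (suc K)) (prodS-unfoldˡ K φ)) (⊛-assoc (φ 0) (prodS K (λ i → φ (suc i))) (φ (suc K)))

-- Congruences of truncated series

infix 4 _≅_mod_below_
record _≅_mod_below_ (f g : Series) (M N : ℕ) : Set where
  constructor congruent
  field divides-at : ∀ k → k < N → + M ℤ∣.∣ f k ℤ.- g k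
open _≅_mod_below_ public

module _ {M N : ℕ} where

  ≅-refl : ∀ {f} → f ≅ f mod M below N
  ≅-refl {f} = congruent λ k _ → subst (_ ℤ∣.∣_) (sym (ℤ.+-inverseʳ (f k))) (divides (+ 0) refl)

  ≅-sym : ∀ {f g} → f ≅ g mod M below N → g ≅ f mod M below N
  ≅-sym {f} {g} f≅g = congruent λ k k<N → subst (_ ℤ∣.∣_) (negate-diff (f k) (g k)) (ℤ∣.∣m⇒∣-m (divides-at f≅g k k<N))
    where
    negate-diff : ∀ x y → - (x ℤ.- y) ≡ y ℤ.- x
    negate-diff = solve-∀

  ≅-trans : ∀ {f g h} → f ≅ g mod M below N → g ≅ h mod M below N → f ≅ h mod M below N
  ≅-trans {f} {g} {h} f≅g g≅h = congruent λ k k<N →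
    subst (_ ℤ∣.∣_) (telescope (f k) (g k) (h k)) (ℤ∣.∣m∣n⇒∣m+n (divides-at f≅g k k<N) (divides-at g≅h k k<N))
    where
    telescope : ∀ x y z → (x ℤ.- y) ℤ.+ (y ℤ.- z) ≡ x ℤ.- z
    telescope = solve-∀

  ≈⇒≅ : ∀ {f g} → f ≈ g → f ≅ g mod M below N
  ≈⇒≅ {f} f≈g = congruent λ k k<N → subst (λ z → + M ℤ∣.∣ f k ℤ.- z) (coeff f≈g k) (divides-at (≅-refl {f}) k k<N)

  ≅-respˡ : ∀ {f f′ g} → f ≈ f′ → f ≅ g mod M below N → f′ ≅ g mod M below N
  ≅-respˡ f≈f′ f≅g = ≅-trans (≈⇒≅ (≈-sym f≈f′)) f≅g

  ≅-resp : ∀ {f f′ g g′} → f ≈ f′ → g ≈ g′ → f ≅ g mod M below N → f′ ≅ g′ mod M below N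
  ≅-resp f≈f′ g≈g′ f≅g = ≅-trans (≅-respˡ f≈f′ f≅g) (≈⇒≅ g≈g′)

  ≅-⊕ : ∀ {f f′ g g′} → f ≅ f′ mod M below N → g ≅ g′ mod M below N → f ⊕ g ≅ f′ ⊕ g′ mod M below N
  ≅-⊕ {f} {f′} {g} {g′} f≅f′ g≅g′ = congruent λ k k<N →
    subst (_ ℤ∣.∣_) (regroup (f k) (f′ k) (g k) (g′ k)) (ℤ∣.∣m∣n⇒∣m+n (divides-at f≅f′ k k<N) (divides-at g≅g′ k k<N))
    where
    regroup : ∀ a b c d → (a ℤ.- b) ℤ.+ (c ℤ.- d) ≡ (a ℤ.+ c) ℤ.- (b ℤ.+ d)
    regroup = solve-∀

  ≅-⊛ : ∀ {f f′ g g′} → f ≅ f′ mod M below N → g ≅ g′ mod M below N → f ⊛ g ≅ f′ ⊛ g′ mod M below N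
  ≅-⊛ {f} {f′} {g} {g′} f≅f′ g≅g′ = congruent λ k k<N →
    subst (_ ℤ∣.∣_) (sumTo-difference k) (∣-sumTo k _ λ i i≤k →
      subst (_ ℤ∣.∣_) (product-difference (f i) (f′ i) (g (k ∸ i)) (g′ (k ∸ i)))
        (ℤ∣.∣m∣n⇒∣m+n (ℤ∣.∣m⇒∣m*n (g (k ∸ i)) (divides-at f≅f′ i (ℕ.≤-<-trans i≤k k<N)))
                      (ℤ∣.∣n⇒∣m*n (f′ i) (divides-at g≅g′ (k ∸ i) (ℕ.≤-<-trans (ℕ.m∸n≤m k i) k<N)))))
    where
    product-difference : ∀ a a′ b b′ → (a ℤ.- a′) ℤ.* b ℤ.+ a′ ℤ.* (b ℤ.- b′) ≡ a ℤ.* b ℤ.- a′ ℤ.* b′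
    product-difference = solve-∀
    sumTo-difference : ∀ k → sumTo k (λ i → f i ℤ.* g (k ∸ i) ℤ.- f′ i ℤ.* g′ (k ∸ i)) ≡ (f ⊛ g) k ℤ.- (f′ ⊛ g′) k
    sumTo-difference k = trans (sumTo-distrib-+ k _ _) (cong (λ z → (f ⊛ g) k ℤ.+ z) (sumTo-neg k _))

  ≅-powS : ∀ {f g} k → f ≅ g mod M below N → powS f k ≅ powS g k mod M below N
  ≅-powS zero    f≅g = ≅-refl
  ≅-powS (suc k) f≅g = ≅-⊛ f≅g (≅-powS k f≅g)

  ≅⇒⊖≅0 : ∀ {f g} → f ≅ g mod M below N → f ⊖ g ≅ zeroS mod M below N
  ≅⇒⊖≅0 f≅g = congruent λ k k<N → subst (_ ℤ∣.∣_) (sym (ℤ.+-identityʳ _)) (divides-at f≅g k k<N)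

  ⊖≅0⇒≅ : ∀ {f g} → f ⊖ g ≅ zeroS mod M below N → f ≅ g mod M below N
  ⊖≅0⇒≅ f⊖g≅0 = congruent λ k k<N → subst (_ ℤ∣.∣_) (ℤ.+-identityʳ _) (divides-at f⊖g≅0 k k<N)

≅-weaken : ∀ {A B N f g} → A ℕ.∣ B → f ≅ g mod B below N → f ≅ g mod A below N
≅-weaken A∣B f≅g = congruent λ k k<N → ℤ∣.∣-trans (ℤ∣.∣ᵤ⇒∣ A∣B) (divides-at f≅g k k<N)

≅0-⊛ : ∀ {A B N f g} → f ≅ zeroS mod A below N → g ≅ zeroS mod B below N → f ⊛ g ≅ zeroS mod A * B below N
≅0-⊛ {A} {B} {N} {f} {g} f≅0 g≅0 = congruent λ k k<N →
  subst (_ ℤ∣.∣_) (sym (ℤ.+-identityʳ _)) (∣-sumTo k _ λ i i≤k →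
    subst₂ ℤ∣._∣_ (sym (ℤ.pos-* A B)) (cong₂ ℤ._*_ (ℤ.+-identityʳ (f i)) (ℤ.+-identityʳ (g (k ∸ i))))
      (*-pres-∣ (divides-at f≅0 i (ℕ.≤-<-trans i≤k k<N)) (divides-at g≅0 (k ∸ i) (ℕ.≤-<-trans (ℕ.m∸n≤m k i) k<N))))
  where
  *-pres-∣ : ∀ {a b x y} → a ℤ∣.∣ x → b ℤ∣.∣ y → a ℤ.* b ℤ∣.∣ x ℤ.* y
  *-pres-∣ {b = b} {x = x} a∣x b∣y = ℤ∣.∣-trans (ℤ∣.*-monoˡ-∣ b a∣x) (ℤ∣.*-monoʳ-∣ x b∣y)

-- Geometric sums and p-adic lifting

natS : ℕ → Series
natS k = scale (+ k) oneS

natS-1 : natS 1 ≈ oneS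
natS-1 = coeffwise λ n → ℤ.*-identityˡ (oneS n)

natS-+ : ∀ a b → natS (a + b) ≈ natS a ⊕ natS b
natS-+ a b = coeffwise λ n → trans (cong (ℤ._* oneS n) (ℤ.pos-+ a b)) (ℤ.*-distribʳ-+ (oneS n) (+ a) (+ b))

natS-suc : ∀ k → natS (suc k) ≈ oneS ⊕ natS k
natS-suc k = ≈-trans (natS-+ 1 k) (+-cong natS-1 (≈-refl {natS k}))

natS-* : ∀ a b → natS (a * b) ≈ natS a ⊛ natS b
natS-* a b = ≈-trans (coeffwise λ n → cong (ℤ._* oneS n) (ℤ.pos-* a b)) (scale-one-* (+ a) (+ b))

natS-⊛ : ∀ k f → natS k ⊛ f ≈ scale (+ k) f
natS-⊛ k f = ≈-trans (scale-⊛ (+ k) oneS f) (coeffwise λ n → cong (+ k ℤ.*_) (coeff (⊛-identityˡ f) n))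

natS-≅0 : ∀ {M N} c → M ℕ.∣ c → natS c ≅ zeroS mod M below N
natS-≅0 {M} c (ℕ.divides q refl) = congruent λ k _ →
  subst (_ ℤ∣.∣_) (sym (ℤ.+-identityʳ (natS (q * M) k))) (ℤ∣.∣m⇒∣m*n (oneS k) (ℤ∣.∣ᵤ⇒∣ {+ M} {+ (q * M)} (ℕ.n∣m*n q)))

geomSum : Series → ℕ → Series
geomSum H zero    = zeroS
geomSum H (suc k) = oneS ⊕ H ⊛ geomSum H k

geomSum₂ : Series → ℕ → Series
geomSum₂ H zero    = zeroS
geomSum₂ H (suc k) = geomSum₂ H k ⊕ geomSum H k

triangle : ℕ → ℕ
triangle zero    = 0
triangle (suc k) = triangle k + k

powS-⊖-oneS : ∀ H k → powS H k ⊖ oneS ≈ (H ⊖ oneS) ⊛ geomSum H k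
powS-⊖-oneS H zero    = solve 1 (λ H → con (+ 1) :- con (+ 1) := (H :- con (+ 1)) :* con (+ 0)) ≈-refl H
powS-⊖-oneS H (suc k) = begin
  H ⊛ powS H k ⊖ oneS                          ≈⟨ split H (powS H k) ⟩
  H ⊛ (powS H k ⊖ oneS) ⊕ (H ⊖ oneS)           ≈⟨ +-cong (⊛-congˡ H (powS-⊖-oneS H k)) (≈-refl {H ⊖ oneS}) ⟩
  H ⊛ ((H ⊖ oneS) ⊛ geomSum H k) ⊕ (H ⊖ oneS)  ≈⟨ factor H (geomSum H k) ⟩
  (H ⊖ oneS) ⊛ (oneS ⊕ H ⊛ geomSum H k)        ∎
  where
  open ≈-Reasoning
  split : ∀ H P → H ⊛ P ⊖ oneS ≈ H ⊛ (P ⊖ oneS) ⊕ (H ⊖ oneS)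
  split = solve 2 (λ H P → H :* P :- con (+ 1) := H :* (P :- con (+ 1)) :+ (H :- con (+ 1))) ≈-refl
  factor : ∀ H G → H ⊛ ((H ⊖ oneS) ⊛ G) ⊕ (H ⊖ oneS) ≈ (H ⊖ oneS) ⊛ (oneS ⊕ H ⊛ G)
  factor = solve 2 (λ H G → H :* ((H :- con (+ 1)) :* G) :+ (H :- con (+ 1))
                            := (H :- con (+ 1)) :* (con (+ 1) :+ H :* G)) ≈-refl

geomSum-unfoldʳ : ∀ H k → geomSum H (suc k) ≈ geomSum H k ⊕ powS H k
geomSum-unfoldʳ H zero    = solve 1 (λ H → con (+ 1) :+ H :* con (+ 0) := con (+ 0) :+ con (+ 1)) ≈-refl H
geomSum-unfoldʳ H (suc k) =
  ≈-trans (+-cong (≈-refl {oneS}) (⊛-congˡ H (geomSum-unfoldʳ H k)))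
          (solve 3 (λ H G P → con (+ 1) :+ H :* (G :+ P) := (con (+ 1) :+ H :* G) :+ H :* P) ≈-refl H (geomSum H k) (powS H k))

geomSum-⊖-natS : ∀ H k → geomSum H k ⊖ natS k ≈ (H ⊖ oneS) ⊛ geomSum₂ H k
geomSum-⊖-natS H zero    = solve 1 (λ H → con (+ 0) :- con (+ 0) := (H :- con (+ 1)) :* con (+ 0)) ≈-refl H
geomSum-⊖-natS H (suc k) = begin
  geomSum H (suc k) ⊖ natS (suc k)                      ≈⟨ +-cong (geomSum-unfoldʳ H k) (-‿cong (natS-suc k)) ⟩
  (geomSum H k ⊕ powS H k) ⊖ (oneS ⊕ natS k)            ≈⟨ regroup (geomSum H k) (powS H k) (natS k) ⟩
  (geomSum H k ⊖ natS k) ⊕ (powS H k ⊖ oneS)            ≈⟨ +-cong (geomSum-⊖-natS H k) (powS-⊖-oneS H k) ⟩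
  (H ⊖ oneS) ⊛ geomSum₂ H k ⊕ (H ⊖ oneS) ⊛ geomSum H k  ≈⟨ ⊛-distribˡ (H ⊖ oneS) (geomSum₂ H k) (geomSum H k) ⟨
  (H ⊖ oneS) ⊛ geomSum₂ H (suc k)                       ∎
  where
  open ≈-Reasoning
  regroup : ∀ G P N → (G ⊕ P) ⊖ (oneS ⊕ N) ≈ (G ⊖ N) ⊕ (P ⊖ oneS)
  regroup = solve 3 (λ G P N → (G :+ P) :- (con (+ 1) :+ N) := (G :- N) :+ (P :- con (+ 1))) ≈-refl

module _ {M N : ℕ} {H : Series} (H≅1 : H ≅ oneS mod M below N) where

  geomSum-≅ : ∀ k → geomSum H k ≅ natS k mod M below N
  geomSum-≅ zero    = ≈⇒≅ (coeffwise λ _ → refl)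
  geomSum-≅ (suc k) = ≅-trans (≅-⊕ (≅-refl {f = oneS}) (≅-⊛ H≅1 (geomSum-≅ k)))
    (≈⇒≅ (≈-trans (+-cong (≈-refl {oneS}) (⊛-identityˡ (natS k))) (≈-sym (natS-suc k))))

  geomSum₂-≅ : ∀ k → geomSum₂ H k ≅ natS (triangle k) mod M below N
  geomSum₂-≅ zero    = ≈⇒≅ (coeffwise λ _ → refl)
  geomSum₂-≅ (suc k) = ≅-trans (≅-⊕ (geomSum₂-≅ k) (geomSum-≅ k)) (≈⇒≅ (≈-sym (natS-+ (triangle k) k)))

powS-linear-error : ∀ H k → powS H k ⊖ (oneS ⊕ natS k ⊛ (H ⊖ oneS)) ≈ (H ⊖ oneS) ⊛ (geomSum H k ⊖ natS k)
powS-linear-error H k = begin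
  powS H k ⊖ (oneS ⊕ natS k ⊛ (H ⊖ oneS))         ≈⟨ regroup (powS H k) (natS k) H ⟩
  (powS H k ⊖ oneS) ⊖ natS k ⊛ (H ⊖ oneS)         ≈⟨ +-cong (powS-⊖-oneS H k) (≈-refl {⊝ (natS k ⊛ (H ⊖ oneS))}) ⟩
  (H ⊖ oneS) ⊛ geomSum H k ⊖ natS k ⊛ (H ⊖ oneS)  ≈⟨ factor H (geomSum H k) (natS k) ⟩
  (H ⊖ oneS) ⊛ (geomSum H k ⊖ natS k)             ∎
  where
  open ≈-Reasoning
  regroup : ∀ P K H → P ⊖ (oneS ⊕ K ⊛ (H ⊖ oneS)) ≈ (P ⊖ oneS) ⊖ K ⊛ (H ⊖ oneS)
  regroup = solve 3 (λ P K H → P :- (con (+ 1) :+ K :* (H :- con (+ 1)))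
                               := (P :- con (+ 1)) :- K :* (H :- con (+ 1))) ≈-refl
  factor : ∀ H G K → (H ⊖ oneS) ⊛ G ⊖ K ⊛ (H ⊖ oneS) ≈ (H ⊖ oneS) ⊛ (G ⊖ K)
  factor = solve 3 (λ H G K → (H :- con (+ 1)) :* G :- K :* (H :- con (+ 1))
                              := (H :- con (+ 1)) :* (G :- K)) ≈-refl

module _ {A B N : ℕ} {H : Series} (H⊖1≅0 : H ⊖ oneS ≅ zeroS mod A below N) (H≅1 : H ≅ oneS mod B below N) where

  powS-≅-linear : ∀ k → powS H k ≅ oneS ⊕ natS k ⊛ (H ⊖ oneS) mod A * B below N
  powS-≅-linear k = ⊖≅0⇒≅ (≅-respˡ (≈-sym (powS-linear-error H k)) (≅0-⊛ H⊖1≅0 (≅⇒⊖≅0 (geomSum-≅ H≅1 k))))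

  powS-≅-linear-sharp : ∀ k → B ℕ.∣ triangle k → powS H k ≅ oneS ⊕ natS k ⊛ (H ⊖ oneS) mod A * A * B below N
  powS-≅-linear-sharp k B∣k = ⊖≅0⇒≅ (≅-respˡ (≈-sym error≈) (≅0-⊛ (≅0-⊛ H⊖1≅0 H⊖1≅0) geomSum₂≅0))
    where
    error≈ : powS H k ⊖ (oneS ⊕ natS k ⊛ (H ⊖ oneS)) ≈ ((H ⊖ oneS) ⊛ (H ⊖ oneS)) ⊛ geomSum₂ H k
    error≈ = ≈-trans (powS-linear-error H k)
               (≈-trans (⊛-congˡ (H ⊖ oneS) (geomSum-⊖-natS H k)) (≈-sym (⊛-assoc (H ⊖ oneS) (H ⊖ oneS) (geomSum₂ H k))))
    geomSum₂≅0 : geomSum₂ H k ≅ zeroS mod B below N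
    geomSum₂≅0 = ≅-trans (geomSum₂-≅ H≅1 k) (natS-≅0 (triangle k) B∣k)

module _ {p N : ℕ} {H : Series} where

  ≅-linear⇒⊖≅0 : ∀ s {Y} c → p ^ s ℕ.∣ c → Y ≅ oneS ⊕ natS c ⊛ (H ⊖ oneS) mod p ^ suc (suc s) below N →
                 H ≅ oneS mod p below N → Y ⊖ oneS ≅ zeroS mod p ^ s * p below N
  ≅-linear⇒⊖≅0 s {Y} c pˢ∣c Y≅ H≅1 =
    ≅-trans (≅-weaken pˢp∣p²⁺ˢ (≅-⊕ Y≅ (≅-refl {f = ⊝ oneS})))
            (≅-respˡ (cancel (natS c ⊛ (H ⊖ oneS))) (≅0-⊛ (natS-≅0 c pˢ∣c) (≅⇒⊖≅0 H≅1)))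
    where
    pˢp∣p²⁺ˢ : p ^ s * p ℕ.∣ p ^ suc (suc s)
    pˢp∣p²⁺ˢ = ℕ.divides p (reorder p (p ^ s))
      where
      reorder : ∀ p x → p * (p * x) ≡ p * (x * p)
      reorder = solveℕ
    cancel : ∀ Z → Z ≈ (oneS ⊕ Z) ⊖ oneS
    cancel = solve 1 (λ Z → Z := (con (+ 1) :+ Z) :- con (+ 1)) ≈-refl

  -- Each p-th power gains one factor p in the error of the linear approximation 1 + k (H - 1).
  powS-≅-linear-pˢ : p ℕ.∣ triangle p → H ≅ oneS mod p below N →
                     ∀ s r → powS H (p ^ s * r) ≅ oneS ⊕ natS (p ^ s * r) ⊛ (H ⊖ oneS) mod p ^ suc (suc s) below N
  powS-≅-linear-pˢ p∣triangle H≅1 zero r =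
    subst (λ t → powS H t ≅ oneS ⊕ natS t ⊛ (H ⊖ oneS) mod p ^ 2 below N) (sym (ℕ.*-identityˡ r))
      (≅-weaken (ℕ.∣-reflexive (cong (p *_) (ℕ.*-identityʳ p))) (powS-≅-linear (≅⇒⊖≅0 H≅1) H≅1 r))
  powS-≅-linear-pˢ p∣triangle H≅1 (suc s) r =
    subst (λ u → powS H u ≅ oneS ⊕ natS u ⊛ (H ⊖ oneS) mod p ^ suc (suc (suc s)) below N) (reorder p (p ^ s) r)
      (≅-resp (≈-sym (powS-* H t p)) (+-cong (≈-refl {oneS}) linear-term≈)
        (≅-trans (≅-weaken pˢ⁺³∣ (powS-≅-linear-sharp Y⊖1≅0 Y≅1 p p∣triangle)) linear-term≅))
    where
    t = p ^ s * r
    Y = powS H t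
    X = H ⊖ oneS
    IH : Y ≅ oneS ⊕ natS t ⊛ X mod p ^ suc (suc s) below N
    IH = powS-≅-linear-pˢ p∣triangle H≅1 s r
    Y⊖1≅0 : Y ⊖ oneS ≅ zeroS mod p ^ s * p below N
    Y⊖1≅0 = ≅-linear⇒⊖≅0 s t (ℕ.m∣m*n r) IH H≅1
    Y≅1 : Y ≅ oneS mod p below N
    Y≅1 = ⊖≅0⇒≅ (≅-weaken (ℕ.n∣m*n (p ^ s)) Y⊖1≅0)
    linear-term≅ : oneS ⊕ natS p ⊛ (Y ⊖ oneS) ≅ oneS ⊕ natS p ⊛ (natS t ⊛ X) mod p ^ suc (suc (suc s)) below N
    linear-term≅ = ≅-⊕ (≅-refl {f = oneS})
      (⊖≅0⇒≅ (≅-respˡ (distribute (natS p) Y (natS t ⊛ X)) (≅0-⊛ (natS-≅0 p ℕ.∣-refl) (≅⇒⊖≅0 IH))))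
      where
      distribute : ∀ P Y C → P ⊛ (Y ⊖ (oneS ⊕ C)) ≈ P ⊛ (Y ⊖ oneS) ⊖ P ⊛ C
      distribute = solve 3 (λ P Y C → P :* (Y :- (con (+ 1) :+ C)) := P :* (Y :- con (+ 1)) :- P :* C) ≈-refl
    linear-term≈ : natS p ⊛ (natS t ⊛ X) ≈ natS (t * p) ⊛ X
    linear-term≈ = ≈-trans (reassociate (natS p) (natS t) X) (⊛-congʳ X (≈-sym (natS-* t p)))
      where
      reassociate : ∀ P T X → P ⊛ (T ⊛ X) ≈ (T ⊛ P) ⊛ X
      reassociate = solve 3 (λ P T X → P :* (T :* X) := (T :* P) :* X) ≈-refl
    pˢ⁺³∣ : p ^ suc (suc (suc s)) ℕ.∣ p ^ s * p * (p ^ s * p) * p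
    pˢ⁺³∣ = ℕ.divides (p ^ s) (square p (p ^ s))
      where
      square : ∀ p x → x * p * (x * p) * p ≡ x * (p * (p * (p * x)))
      square = solveℕ
    reorder : ∀ p x r → x * r * p ≡ p * x * r
    reorder = solveℕ

-- Dilation x ↦ xᵃ

compress : ℕ → Series → Series
compress a f j = f (j * a)

module _ (a : ℕ) where

  private
    term : Series → ℕ → ℕ → ℤ
    term f n k = if k * a ≡ᵇ n then f k else + 0

    term-hit : ∀ f {n} k → k * a ≡ n → term f n k ≡ f k
    term-hit f {n} k k*a≡n with k * a ≡ᵇ n | ℕ.≡⇒≡ᵇ (k * a) n k*a≡n
    ... | true | _ = refl

    term-miss : ∀ f {n} k → k * a ≢ n → term f n k ≡ + 0
    term-miss f {n} k k*a≢n with k * a ≡ᵇ n in eq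
    ... | true  = ⊥-elim (k*a≢n (ℕ.≡ᵇ⇒≡ (k * a) n (subst T (sym eq) _)))
    ... | false = refl

  dilate-mult : .{{NonZero a}} → ∀ f q → dilate a f (q * a) ≡ f q
  dilate-mult f q = trans (sumTo-single (q * a) q (term f (q * a)) (ℕ.m≤m*n q a)
                             λ k _ k≢q → term-miss f k (k≢q ∘ ℕ.*-cancelʳ-≡ k q a))
                          (term-hit f q refl)

  dilate-nonmult : ∀ f {n} → ¬ a ℕ.∣ n → dilate a f n ≡ + 0
  dilate-nonmult f {n} a∤n = sumTo-zero n (term f n) λ k _ → term-miss f k (a∤n ∘ ℕ.divides k ∘ sym)

  dilate-cong : ∀ {f g} → f ≈ g → dilate a f ≈ dilate a g
  dilate-cong f≈g = coeffwise λ n → sumTo-cong n λ k _ → cong (λ z → if k * a ≡ᵇ n then z else + 0) (coeff f≈g k)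

sumTo-multiples : ∀ a .{{_ : NonZero a}} q (φ : ℕ → ℤ) → (∀ k → ¬ a ℕ.∣ k → φ k ≡ + 0) →
                  sumTo (q * a) φ ≡ sumTo q (λ j → φ (j * a))
sumTo-multiples a        zero    φ φ≡0 = refl
sumTo-multiples a@(suc a′) (suc q) φ φ≡0 = begin
  sumTo (a + q * a) φ                                     ≡⟨ cong (λ n → sumTo n φ) (ℕ.+-comm a (q * a)) ⟩
  sumTo (q * a + suc a′) φ                                ≡⟨ sumTo-split (q * a) a′ φ ⟩
  sumTo (q * a) φ ℤ.+ sumTo a′ (λ i → φ (q * a + suc i))  ≡⟨ cong₂ ℤ._+_ (sumTo-multiples a q φ φ≡0) (sumTo-single a′ a′ _ ℕ.≤-refl between) ⟩
  sumTo q (λ j → φ (j * a)) ℤ.+ φ (q * a + a)             ≡⟨ cong (λ n → sumTo q (λ j → φ (j * a)) ℤ.+ φ n) (ℕ.+-comm (q * a) a) ⟩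
  sumTo (suc q) (λ j → φ (j * a))                         ∎
  where
  open ≡-Reasoning
  between : ∀ i → i ≤ a′ → i ≢ a′ → φ (q * a + suc i) ≡ + 0
  between i i≤a′ i≢a′ = φ≡0 _ λ a∣ →
    ℕ.<⇒≱ (s≤s (ℕ.≤∧≢⇒< i≤a′ i≢a′)) (ℕ.∣⇒≤ (ℕ.∣m+n∣m⇒∣n a∣ (ℕ.n∣m*n q)))

module _ (a : ℕ) .{{_ : NonZero a}} where

  compress-dilate : ∀ f → compress a (dilate a f) ≈ f
  compress-dilate f = coeffwise (dilate-mult a f)

  ≅-dilate : ∀ {M N f g} → f ≅ g mod M below N → dilate a f ≅ dilate a g mod M below N
  ≅-dilate {M} {N} {f} {g} f≅g = congruent λ k k<N → case k k<N (a ℕ.∣? k)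
    where
    case : ∀ k → k < N → Dec (a ℕ.∣ k) → + M ℤ∣.∣ dilate a f k ℤ.- dilate a g k
    case k k<N (yes (ℕ.divides q refl)) =
      subst (_ ℤ∣.∣_) (sym (cong₂ ℤ._-_ (dilate-mult a f q) (dilate-mult a g q))) (divides-at f≅g q (ℕ.≤-<-trans (ℕ.m≤m*n q a) k<N))
    case k k<N (no a∤k) =
      subst (_ ℤ∣.∣_) (sym (cong₂ ℤ._-_ (dilate-nonmult a f a∤k) (dilate-nonmult a g a∤k))) (divides (+ 0) refl)

  ≅-compress : ∀ {M N f g} → f ≅ g mod M below N * a → compress a f ≅ compress a g mod M below N
  ≅-compress f≅g = congruent λ j j<N → divides-at f≅g (j * a) (ℕ.*-monoˡ-< a j<N)

  ≅-dilate-compress : ∀ {M N f} → (∀ {k} → ¬ a ℕ.∣ k → + M ℤ∣.∣ f k) → f ≅ dilate a (compress a f) mod M below N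
  ≅-dilate-compress {M} {f = f} M∣off = congruent λ k _ → case k (a ℕ.∣? k)
    where
    case : ∀ k → Dec (a ℕ.∣ k) → + M ℤ∣.∣ f k ℤ.- dilate a (compress a f) k
    case _ (yes (ℕ.divides q refl)) =
      subst (_ ℤ∣.∣_) (sym (trans (cong (λ z → f (q * a) ℤ.- z) (dilate-mult a (compress a f) q)) (ℤ.+-inverseʳ (f (q * a)))))
            (divides (+ 0) refl)
    case k (no a∤k) =
      subst (_ ℤ∣.∣_) (sym (trans (cong (λ z → f k ℤ.- z) (dilate-nonmult a (compress a f) a∤k)) (ℤ.+-identityʳ (f k)))) (M∣off a∤k)

  dilate-⊛-mult : ∀ h f q → (dilate a h ⊛ f) (q * a) ≡ (h ⊛ compress a f) q
  dilate-⊛-mult h f q =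
    trans (sumTo-multiples a q _ λ k a∤k → cong (ℤ._* f (q * a ∸ k)) (dilate-nonmult a h a∤k))
          (sumTo-cong q λ j _ → cong₂ ℤ._*_ (dilate-mult a h j) (cong f (sym (ℕ.*-distribʳ-∸ a q j))))

  dilate-⊛ : ∀ f g → dilate a (f ⊛ g) ≈ dilate a f ⊛ dilate a g
  dilate-⊛ f g = coeffwise λ n → case n (a ℕ.∣? n)
    where
    case : ∀ n → Dec (a ℕ.∣ n) → dilate a (f ⊛ g) n ≡ (dilate a f ⊛ dilate a g) n
    case _ (yes (ℕ.divides q refl)) =
      trans (dilate-mult a (f ⊛ g) q) (sym (trans (dilate-⊛-mult f (dilate a g) q) (coeff (⊛-congˡ f (compress-dilate g)) q)))
    case n (no a∤n) = trans (dilate-nonmult a (f ⊛ g) a∤n) (sym (sumTo-zero n _ λ k k≤n → vanishes k k≤n (a ℕ.∣? k)))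
      where
      vanishes : ∀ k → k ≤ n → Dec (a ℕ.∣ k) → dilate a f k ℤ.* dilate a g (n ∸ k) ≡ + 0
      vanishes k _ (no a∤k) = cong (ℤ._* dilate a g (n ∸ k)) (dilate-nonmult a f a∤k)
      vanishes k k≤n (yes a∣k) = trans (cong (dilate a f k ℤ.*_) (dilate-nonmult a g a∤n∸k)) (ℤ.*-zeroʳ (dilate a f k))
        where
        a∤n∸k : ¬ a ℕ.∣ n ∸ k
        a∤n∸k a∣n∸k = a∤n (subst (a ℕ.∣_) (ℕ.m∸n+n≡m k≤n) (ℕ.∣m∣n⇒∣m+n a∣n∸k a∣k))

  compress-oneS : compress a oneS ≈ oneS
  compress-oneS = coeffwise at
    where
    oneS-nonzero : ∀ n .{{_ : NonZero n}} → oneS n ≡ + 0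
    oneS-nonzero (suc n) = refl
    at : ∀ j → oneS (j * a) ≡ oneS j
    at zero    = refl
    at (suc j) = oneS-nonzero (suc j * a) {{ℕ.m*n≢0 (suc j) a}}

  compress-linear : ∀ m f → compress a f ≈ oneS → compress a (oneS ⊕ natS m ⊛ (f ⊖ oneS)) ≈ oneS
  compress-linear m f compress-f≈1 = coeffwise λ j → begin
    oneS (j * a) ℤ.+ (natS m ⊛ (f ⊖ oneS)) (j * a)         ≡⟨ cong (λ z → oneS (j * a) ℤ.+ z) (coeff (natS-⊛ m (f ⊖ oneS)) (j * a)) ⟩
    oneS (j * a) ℤ.+ + m ℤ.* (f (j * a) ℤ.- oneS (j * a))  ≡⟨ cong₂ (λ x y → x ℤ.+ + m ℤ.* (y ℤ.- x)) (coeff compress-oneS j) (coeff compress-f≈1 j) ⟩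
    oneS j ℤ.+ + m ℤ.* (oneS j ℤ.- oneS j)                 ≡⟨ vanish (oneS j) (+ m) ⟩
    oneS j                                                 ∎
    where
    open ≡-Reasoning
    vanish : ∀ x c → x ℤ.+ c ℤ.* (x ℤ.- x) ≡ x
    vanish = solve-∀

  dilate-oneS : dilate a oneS ≈ oneS
  dilate-oneS = coeffwise λ n → case n (a ℕ.∣? n)
    where
    case : ∀ n → Dec (a ℕ.∣ n) → dilate a oneS n ≡ oneS n
    case _       (yes (ℕ.divides q refl)) = trans (dilate-mult a oneS q) (sym (coeff compress-oneS q))
    case zero    (no a∤0)                 = ⊥-elim (a∤0 (a ℕ.∣0))
    case (suc n) (no a∤n)                 = dilate-nonmult a oneS a∤n

  dilate-powS : ∀ f k → dilate a (powS f k) ≈ powS (dilate a f) k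
  dilate-powS f zero    = dilate-oneS
  dilate-powS f (suc k) = ≈-trans (dilate-⊛ f (powS f k)) (⊛-congˡ (dilate a f) (dilate-powS f k))

  dilate-prodS : ∀ K φ → dilate a (prodS K φ) ≈ prodS K (λ i → dilate a (φ i))
  dilate-prodS zero    φ = dilate-oneS
  dilate-prodS (suc K) φ = ≈-trans (dilate-⊛ (prodS K φ) (φ K)) (⊛-congʳ (dilate a (φ K)) (dilate-prodS K φ))

dilate-1 : ∀ f → dilate 1 f ≈ f
dilate-1 f = coeffwise λ n → trans (cong (dilate 1 f) (sym (ℕ.*-identityʳ n))) (dilate-mult 1 f n)

dilate-dilate : ∀ a b .{{_ : NonZero a}} .{{_ : NonZero b}} f → dilate a (dilate b f) ≈ dilate (b * a) f
dilate-dilate a b f = coeffwise λ n → case n (a ℕ.∣? n)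
  where
  instance
    ba≢0 : NonZero (b * a)
    ba≢0 = ℕ.m*n≢0 b a
  case : ∀ n → Dec (a ℕ.∣ n) → dilate a (dilate b f) n ≡ dilate (b * a) f n
  case _ (yes (ℕ.divides q refl)) with b ℕ.∣? q
  ... | yes (ℕ.divides j refl) =
    trans (dilate-mult a (dilate b f) (j * b))
          (trans (dilate-mult b f j) (sym (trans (cong (dilate (b * a) f) (ℕ.*-assoc j b a)) (dilate-mult (b * a) f j))))
  ... | no b∤q =
    trans (dilate-mult a (dilate b f) q)
          (trans (dilate-nonmult b f b∤q) (sym (dilate-nonmult (b * a) f (b∤q ∘ ℕ.*-cancelʳ-∣ a))))
  case n (no a∤n) =
    trans (dilate-nonmult a (dilate b f) a∤n) (sym (dilate-nonmult (b * a) f (a∤n ∘ ℕ.m*n∣⇒n∣ b a)))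

-- Powers of 1 - x

oneMinusX-⊛-suc : ∀ f n → (oneMinusX ⊛ f) (suc n) ≡ f (suc n) ℤ.- f n
oneMinusX-⊛-suc f n =
  trans (⊛-unfold oneMinusX f n)
        (cong₂ ℤ._+_ (ℤ.*-identityˡ (f (suc n))) (trans (sumTo-single n 0 _ z≤n vanishes) (ℤ.-1*i≡-i (f n))))
  where
  vanishes : ∀ k → k ≤ n → k ≢ 0 → shift oneMinusX k ℤ.* f (n ∸ k) ≡ + 0
  vanishes zero    _ k≢0 = ⊥-elim (k≢0 refl)
  vanishes (suc k) _ _   = refl

oneMinusX⊛geomS : oneMinusX ⊛ geomS ≈ oneS
oneMinusX⊛geomS = coeffwise λ where
  zero    → refl
  (suc n) → oneMinusX-⊛-suc geomS n

geomS⊛oneMinusX : geomS ⊛ oneMinusX ≈ oneS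
geomS⊛oneMinusX = ≈-trans (⊛-comm geomS oneMinusX) oneMinusX⊛geomS

dilate-geomS⊛oneMinusX : ∀ a .{{_ : NonZero a}} → dilate a geomS ⊛ dilate a oneMinusX ≈ oneS
dilate-geomS⊛oneMinusX a =
  ≈-trans (≈-sym (dilate-⊛ a geomS oneMinusX))
          (≈-trans (dilate-cong a geomS⊛oneMinusX) (dilate-oneS a))

powS-oneMinusX : ∀ k j → powS oneMinusX k j ≡ ℤ.-1ℤ ℤ.^ j ℤ.* + (k C j)
powS-oneMinusX zero    zero    = refl
powS-oneMinusX zero    (suc j) = sym (ℤ.*-zeroʳ (ℤ.-1ℤ ℤ.^ suc j))
powS-oneMinusX (suc k) zero    = cong (+ 1 ℤ.*_) (powS-oneMinusX k zero)
powS-oneMinusX (suc k) (suc j) = begin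
  (oneMinusX ⊛ powS oneMinusX k) (suc j)             ≡⟨ oneMinusX-⊛-suc (powS oneMinusX k) j ⟩
  powS oneMinusX k (suc j) ℤ.- powS oneMinusX k j    ≡⟨ cong₂ ℤ._-_ (powS-oneMinusX k (suc j)) (powS-oneMinusX k j) ⟩
  ℤ.-1ℤ ℤ.* s ℤ.* + (k C suc j) ℤ.- s ℤ.* + (k C j)  ≡⟨ collect s (+ (k C suc j)) (+ (k C j)) ⟩
  ℤ.-1ℤ ℤ.* s ℤ.* (+ (k C j) ℤ.+ + (k C suc j))      ≡⟨ cong (ℤ.-1ℤ ℤ.* s ℤ.*_) pascal ⟩
  ℤ.-1ℤ ℤ.* s ℤ.* + (suc k C suc j)                  ∎
  where
  open ≡-Reasoning
  s = ℤ.-1ℤ ℤ.^ j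
  collect : ∀ s x y → ℤ.-1ℤ ℤ.* s ℤ.* x ℤ.- s ℤ.* y ≡ ℤ.-1ℤ ℤ.* s ℤ.* (y ℤ.+ x)
  collect = solve-∀
  pascal : + (k C j) ℤ.+ + (k C suc j) ≡ + (suc k C suc j)
  pascal = trans (sym (ℤ.pos-+ (k C j) (k C suc j))) (cong +_ (nCk+nC[k+1]≡[n+1]C[k+1] k j))

powS-oneMinusX-above : ∀ {k n} → k < n → powS oneMinusX k n ≡ + 0
powS-oneMinusX-above {k} {n} k<n =
  trans (powS-oneMinusX k n) (trans (cong (λ c → ℤ.-1ℤ ℤ.^ n ℤ.* + c) (k>n⇒nCk≡0 k<n)) (ℤ.*-zeroʳ (ℤ.-1ℤ ℤ.^ n)))

C-absorption : ∀ k j → suc j * (suc k C suc j) ≡ suc k * (k C j)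
C-absorption zero    zero    = refl
C-absorption zero    (suc j) = ℕ.*-zeroʳ (suc (suc j))
C-absorption (suc k) zero    = trans (ℕ.*-identityˡ _) (trans (nC1≡n (suc (suc k))) (sym (ℕ.*-identityʳ (suc (suc k)))))
C-absorption (suc k) (suc j) = begin
  suc (suc j) * (suc (suc k) C suc (suc j))                            ≡⟨ cong (suc (suc j) *_) (nCk+nC[k+1]≡[n+1]C[k+1] (suc k) (suc j)) ⟨
  suc (suc j) * (suc k C suc j + suc k C suc (suc j))                  ≡⟨ ℕ.*-distribˡ-+ (suc (suc j)) (suc k C suc j) _ ⟩
  suc (suc j) * (suc k C suc j) + suc (suc j) * (suc k C suc (suc j))  ≡⟨ cong (suc (suc j) * (suc k C suc j) ℕ.+_) (C-absorption k (suc j)) ⟩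
  suc k C suc j + suc j * (suc k C suc j) + suc k * (k C suc j)        ≡⟨ cong (λ z → suc k C suc j + z + suc k * (k C suc j)) (C-absorption k j) ⟩
  suc k C suc j + suc k * (k C j) + suc k * (k C suc j)                ≡⟨ regroup (suc k C suc j) (suc k) (k C j) (k C suc j) ⟩
  suc k C suc j + suc k * (k C j + k C suc j)                          ≡⟨ cong (λ z → suc k C suc j + suc k * z) (nCk+nC[k+1]≡[n+1]C[k+1] k j) ⟩
  suc (suc k) * (suc k C suc j)                                        ∎
  where
  open ≡-Reasoning
  regroup : ∀ a b c d → a + b * c + b * d ≡ a + b * (c + d)
  regroup = solveℕ

prime∣C : ∀ {p j} → Prime p → 0 < j → j < p → p ℕ.∣ p C j
prime∣C {suc k} {suc j} p-prime _ j<p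
  with euclidsLemma (suc j) (suc k C suc j) p-prime (subst (suc k ℕ.∣_) (sym (C-absorption k j)) (ℕ.m∣m*n (k C j)))
... | inj₁ p∣j = ⊥-elim (ℕ.<⇒≱ j<p (ℕ.∣⇒≤ p∣j))
... | inj₂ p∣C = p∣C

2∣⊎-1ℤ^≡-1ℤ : ∀ n → 2 ℕ.∣ n ⊎ ℤ.-1ℤ ℤ.^ n ≡ ℤ.-1ℤ
2∣⊎-1ℤ^≡-1ℤ zero          = inj₁ (ℕ.divides 0 refl)
2∣⊎-1ℤ^≡-1ℤ (suc zero)    = inj₂ refl
2∣⊎-1ℤ^≡-1ℤ (suc (suc n)) with 2∣⊎-1ℤ^≡-1ℤ n
... | inj₁ 2∣n  = inj₁ (ℕ.∣m∣n⇒∣m+n ℕ.∣-refl 2∣n)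
... | inj₂ odd  = inj₂ (cong (λ z → ℤ.-1ℤ ℤ.* (ℤ.-1ℤ ℤ.* z)) odd)

triangle-*2 : ∀ k → triangle (suc k) * 2 ≡ suc k * k
triangle-*2 zero    = refl
triangle-*2 (suc k) = trans (ℕ.*-distribʳ-+ 2 (triangle (suc k)) (suc k)) (trans (cong (_+ suc k * 2) (triangle-*2 k)) (expand k))
  where
  expand : ∀ k → suc k * k + suc k * 2 ≡ suc (suc k) * suc k
  expand = solveℕ

n<pⁿ : ∀ {p} → 2 ≤ p → ∀ n → n < p ^ n
n<pⁿ 2≤p zero    = s≤s z≤n
n<pⁿ {p} 2≤p (suc n) = ℕ.<-≤-trans (ℕ.+-monoʳ-< 1 (n<pⁿ 2≤p n)) (begin
  1 + p ^ n      ≤⟨ ℕ.+-monoˡ-≤ (p ^ n) (ℕ.≤-<-trans z≤n (n<pⁿ 2≤p n)) ⟩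
  p ^ n + p ^ n  ≡⟨ cong (p ^ n ℕ.+_) (ℕ.+-identityʳ (p ^ n)) ⟨
  2 * p ^ n      ≤⟨ ℕ.*-monoˡ-≤ (p ^ n) 2≤p ⟩
  p * p ^ n      ∎)
  where open ℕ.≤-Reasoning

p^νgo∣ : ∀ p fuel m → p ^ νgo p fuel m ℕ.∣ m
p^νgo∣ p zero       m       = ℕ.1∣ m
p^νgo∣ p (suc fuel) zero    = ℕ.1∣ 0
p^νgo∣ p (suc fuel) (suc m) with p ℕ.∣? suc m
... | no  _                  = ℕ.1∣ suc m
... | yes (ℕ.divides q m+1≡q*p) =
  subst (p * p ^ νgo p fuel q ℕ.∣_) (trans (ℕ.*-comm p q) (sym m+1≡q*p)) (ℕ.*-monoʳ-∣ p (p^νgo∣ p fuel q))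

p^ν∣ : ∀ p m → p ^ ν p m ℕ.∣ m
p^ν∣ p m = p^νgo∣ p m m

prime∣triangle : ∀ {p} → Prime p → 3 ≤ p → p ℕ.∣ triangle p
prime∣triangle {suc k} p-prime 3≤p
  with euclidsLemma (triangle (suc k)) 2 p-prime (subst (suc k ℕ.∣_) (sym (triangle-*2 k)) (ℕ.m∣m*n k))
... | inj₁ p∣triangle = p∣triangle
... | inj₂ p∣2        = ⊥-elim (ℕ.<⇒≱ 3≤p (ℕ.∣⇒≤ p∣2))

-- The generating functions of dₘ

module _ {p : ℕ} (p-prime : Prime p) (3≤p : 3 ≤ p) where

  2∤p : ¬ 2 ℕ.∣ p
  2∤p 2∣p with prime⇒irreducible p-prime 2∣p
  ... | inj₁ ()
  ... | inj₂ 2≡p = ℕ.<⇒≢ 3≤p 2≡p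

  -1ℤ^p≡-1ℤ : ℤ.-1ℤ ℤ.^ p ≡ ℤ.-1ℤ
  -1ℤ^p≡-1ℤ with 2∣⊎-1ℤ^≡-1ℤ p
  ... | inj₁ 2∣p = ⊥-elim (2∤p 2∣p)
  ... | inj₂ odd = odd

  instance
    p≢0 : NonZero p
    p≢0 = ℕ.>-nonZero (ℕ.<-≤-trans (s≤s z≤n) 3≤p)

  compress-powS-oneMinusX : compress p (powS oneMinusX p) ≈ oneMinusX
  compress-powS-oneMinusX = coeffwise at
    where
    top-coefficient : powS oneMinusX p p ≡ ℤ.-1ℤ
    top-coefficient = begin
      powS oneMinusX p p         ≡⟨ powS-oneMinusX p p ⟩
      ℤ.-1ℤ ℤ.^ p ℤ.* + (p C p)  ≡⟨ cong (λ c → ℤ.-1ℤ ℤ.^ p ℤ.* + c) (nCn≡1 p) ⟩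
      ℤ.-1ℤ ℤ.^ p ℤ.* + 1        ≡⟨ ℤ.*-identityʳ _ ⟩
      ℤ.-1ℤ ℤ.^ p                ≡⟨ -1ℤ^p≡-1ℤ ⟩
      ℤ.-1ℤ                      ∎
      where open ≡-Reasoning
    at : ∀ j → powS oneMinusX p (j * p) ≡ oneMinusX j
    at zero          = powS-oneMinusX p 0
    at (suc zero)    = trans (cong (powS oneMinusX p) (ℕ.*-identityˡ p)) top-coefficient
    at (suc (suc q)) = powS-oneMinusX-above (ℕ.m<m+n p (ℕ.>-nonZero⁻¹ (suc q * p) {{ℕ.m*n≢0 (suc q) p}}))

  p∣powS-oneMinusX : ∀ {k} → ¬ p ℕ.∣ k → + p ℤ∣.∣ powS oneMinusX p k
  p∣powS-oneMinusX {k} p∤k with ℕ.<-cmp k p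
  ... | tri< k<p _ _ = subst (_ ℤ∣.∣_) (sym (powS-oneMinusX p k))
                         (ℤ∣.∣n⇒∣m*n (ℤ.-1ℤ ℤ.^ k) (ℤ∣.∣ᵤ⇒∣ (prime∣C p-prime (0<k p∤k) k<p)))
    where
    0<k : ∀ {k} → ¬ p ℕ.∣ k → 0 < k
    0<k {zero}  p∤0 = ⊥-elim (p∤0 (p ℕ.∣0))
    0<k {suc k} _   = s≤s z≤n
  ... | tri≈ _ k≡p _ = ⊥-elim (p∤k (ℕ.∣-reflexive (sym k≡p)))
  ... | tri> _ _ p<k = subst (_ ℤ∣.∣_) (sym (powS-oneMinusX-above p<k)) (divides (+ 0) refl)

  frobenius : ∀ {N} → powS oneMinusX p ≅ dilate p oneMinusX mod p below N
  frobenius = ≅-trans (≅-dilate-compress p p∣powS-oneMinusX) (≈⇒≅ (dilate-cong p compress-powS-oneMinusX))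

  pⁱ≢0 : ∀ i → NonZero (p ^ i)
  pⁱ≢0 i = ℕ.m^n≢0 p i

  partialProduct : Series → ℕ → Series
  partialProduct h K = h ⊛ prodS K (λ i → powS (dilate (p ^ i) h) (p ∸ 1))

  -- The products defining Σ d₁(n) xⁿ and Σ d₋₁(n) xⁿ, truncated to the factors i < K.
  F G : ℕ → Series
  F = partialProduct geomS
  G = partialProduct oneMinusX

  partialProduct-unfoldʳ : ∀ h K → partialProduct h (suc K) ≈ partialProduct h K ⊛ powS (dilate (p ^ K) h) (p ∸ 1)
  partialProduct-unfoldʳ h K = ≈-sym (⊛-assoc h (prodS K (λ i → powS (dilate (p ^ i) h) (p ∸ 1))) (powS (dilate (p ^ K) h) (p ∸ 1)))

  partialProduct-powS : ∀ h K m →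
    powS h m ⊛ prodS K (λ i → dilate (p ^ i) (powS h ((p ∸ 1) * m))) ≈ powS (partialProduct h K) m
  partialProduct-powS h K m = ≈-trans (⊛-congˡ (powS h m) (≈-trans (prodS-cong K factor≈) (prodS-powS K _ m)))
                                      (≈-sym (powS-distrib-⊛ h (prodS K (λ i → powS (dilate (p ^ i) h) (p ∸ 1))) m))
    where
    factor≈ : ∀ i → dilate (p ^ i) (powS h ((p ∸ 1) * m)) ≈ powS (powS (dilate (p ^ i) h) (p ∸ 1)) m
    factor≈ i = ≈-trans (dilate-powS (p ^ i) {{pⁱ≢0 i}} h ((p ∸ 1) * m)) (powS-* (dilate (p ^ i) h) (p ∸ 1) m)

  powS-p : ∀ f → f ⊛ powS f (p ∸ 1) ≈ powS f p
  powS-p f = ≈-reflexive (cong (powS f) (ℕ.m+[n∸m]≡n {1} {p} (ℕ.<-≤-trans (s≤s z≤n) 3≤p)))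

  d[m]≡Fᵐ : ∀ m n → d p (+ m) n ≡ powS (F (suc n)) m n
  d[m]≡Fᵐ m n = coeff (≈-trans (⊛-congˡ (powS geomS m) (prodS-cong (suc n) factor≈)) (partialProduct-powS geomS (suc n) m)) n
    where
    factor≈ : ∀ i → dilate (p ^ i) (invPow (+ (p ∸ 1) ℤ.* + m)) ≈ dilate (p ^ i) (powS geomS ((p ∸ 1) * m))
    factor≈ i = dilate-cong (p ^ i) (≈-reflexive (cong invPow (sym (ℤ.pos-* (p ∸ 1) m))))

  d[-m]≡Gᵐ : ∀ m n → d p (- (+ suc m)) n ≡ powS (G (suc n)) (suc m) n
  d[-m]≡Gᵐ m n =
    coeff (≈-trans (⊛-congˡ (powS oneMinusX (suc m)) (prodS-cong (suc n) factor≈)) (partialProduct-powS oneMinusX (suc n) (suc m))) n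
    where
    invPow-neg : ∀ b → invPow (+ b ℤ.* -[1+ m ]) ≡ powS oneMinusX (b * suc m)
    invPow-neg zero    = refl
    invPow-neg (suc b) = refl
    factor≈ : ∀ i → dilate (p ^ i) (invPow (+ (p ∸ 1) ℤ.* -[1+ m ])) ≈ dilate (p ^ i) (powS oneMinusX ((p ∸ 1) * suc m))
    factor≈ i = dilate-cong (p ^ i) (≈-reflexive (invPow-neg (p ∸ 1)))

  F⊛G : ∀ K → F K ⊛ G K ≈ oneS
  F⊛G K = begin
    F K ⊛ G K                                      ≈⟨ ⊛-interchange geomS (prodS K φ) oneMinusX (prodS K ψ) ⟩
    (geomS ⊛ oneMinusX) ⊛ (prodS K φ ⊛ prodS K ψ)  ≈⟨ ⊛-cong geomS⊛oneMinusX (≈-sym (prodS-distrib-⊛ K φ ψ)) ⟩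
    oneS ⊛ prodS K (λ i → φ i ⊛ ψ i)               ≈⟨ ⊛-congˡ oneS (prodS-oneS K _ φ⊛ψ≈1) ⟩
    oneS ⊛ oneS                                    ≈⟨ ⊛-identityˡ oneS ⟩
    oneS                                           ∎
    where
    open ≈-Reasoning
    φ ψ : ℕ → Series
    φ i = powS (dilate (p ^ i) geomS) (p ∸ 1)
    ψ i = powS (dilate (p ^ i) oneMinusX) (p ∸ 1)
    φ⊛ψ≈1 : ∀ i → φ i ⊛ ψ i ≈ oneS
    φ⊛ψ≈1 i = ≈-trans (≈-sym (powS-distrib-⊛ _ _ (p ∸ 1)))
                      (≈-trans (powS-cong (p ∸ 1) (dilate-geomS⊛oneMinusX (p ^ i) {{pⁱ≢0 i}})) (powS-oneS (p ∸ 1)))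

  G≅dilate : ∀ {N} K → G K ≅ dilate (p ^ K) oneMinusX mod p below N
  G≅dilate zero    = ≈⇒≅ (≈-trans (⊛-identityʳ oneMinusX) (≈-sym (dilate-1 oneMinusX)))
  G≅dilate (suc K) =
    ≅-respˡ (≈-sym (partialProduct-unfoldʳ oneMinusX K))
      (≅-trans (≅-⊛ (G≅dilate K) (≅-refl {f = powS (dilate (p ^ K) oneMinusX) (p ∸ 1)}))
      (≅-resp (≈-trans (dilate-powS (p ^ K) {{pⁱ≢0 K}} oneMinusX p) (≈-sym (powS-p (dilate (p ^ K) oneMinusX))))
              (dilate-dilate (p ^ K) p {{pⁱ≢0 K}} oneMinusX)
              (≅-dilate (p ^ K) {{pⁱ≢0 K}} frobenius)))

  dilate-oneMinusX≅1 : ∀ {N} K → N ≤ p ^ K → dilate (p ^ K) oneMinusX ≅ oneS mod 0 below N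
  dilate-oneMinusX≅1 K N≤pᴷ = congruent λ k k<N → subst (_ ℤ∣.∣_) (sym (exact k (ℕ.<-≤-trans k<N N≤pᴷ))) (divides (+ 0) refl)
    where
    instance _ = pⁱ≢0 K
    exact : ∀ k → k < p ^ K → dilate (p ^ K) oneMinusX k ℤ.- oneS k ≡ + 0
    exact zero    _      = cong (ℤ._- + 1) (dilate-mult (p ^ K) oneMinusX 0)
    exact (suc k) k<pᴷ  = cong (ℤ._- + 0) (dilate-nonmult (p ^ K) oneMinusX λ pᴷ∣ → ℕ.<⇒≱ k<pᴷ (ℕ.∣⇒≤ pᴷ∣))

  G≅1 : ∀ {N} K → N ≤ p ^ K → G K ≅ oneS mod p below N
  G≅1 K N≤pᴷ = ≅-trans (G≅dilate K) (≅-weaken (p ℕ.∣0) (dilate-oneMinusX≅1 K N≤pᴷ))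

  F≅1 : ∀ {N} K → N ≤ p ^ K → F K ≅ oneS mod p below N
  F≅1 K N≤pᴷ = ⊖≅0⇒≅ (≅-resp F⊛[1⊖G]≈F⊖1 (⊛-zeroʳ (F K)) (≅-⊛ (≅-refl {f = F K}) (≅⇒⊖≅0 (≅-sym (G≅1 K N≤pᴷ)))))
    where
    F⊛[1⊖G]≈F⊖1 : F K ⊛ (oneS ⊖ G K) ≈ F K ⊖ oneS
    F⊛[1⊖G]≈F⊖1 = ≈-trans (distribute (F K) (G K)) (+-cong (≈-refl {F K}) (-‿cong (F⊛G K)))
      where
      distribute : ∀ F G → F ⊛ (oneS ⊖ G) ≈ F ⊖ F ⊛ G
      distribute = solve 2 (λ F G → F :* (con (+ 1) :- G) := F :- F :* G) ≈-refl

  -- w = (1 - x)ᵖ / (1 - xᵖ)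
  w : Series
  w = powS oneMinusX p ⊛ dilate p geomS

  w≅1 : ∀ {N} → w ≅ oneS mod p below N
  w≅1 = ≅-trans (≅-⊛ frobenius (≅-refl {f = dilate p geomS}))
                (≈⇒≅ (≈-trans (⊛-comm (dilate p oneMinusX) (dilate p geomS)) (dilate-geomS⊛oneMinusX p)))

  compress-w : compress p w ≈ oneS
  compress-w = coeffwise λ j → begin
    w (j * p)                                    ≡⟨ coeff (⊛-comm (powS oneMinusX p) (dilate p geomS)) (j * p) ⟩
    (dilate p geomS ⊛ powS oneMinusX p) (j * p)  ≡⟨ dilate-⊛-mult p geomS (powS oneMinusX p) j ⟩
    (geomS ⊛ compress p (powS oneMinusX p)) j    ≡⟨ coeff (⊛-congˡ geomS compress-powS-oneMinusX) j ⟩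
    (geomS ⊛ oneMinusX) j                        ≡⟨ coeff geomS⊛oneMinusX j ⟩
    oneS j                                       ∎
    where open ≡-Reasoning

  G-step : ∀ K → G (suc K) ≈ w ⊛ dilate p (G K)
  G-step K = ≈-sym (begin
    w ⊛ dilate p (G K)                                ≈⟨ ⊛-congˡ w dilate-G ⟩
    (Cᵖ ⊛ dilate p geomS) ⊛ (dilate p oneMinusX ⊛ R)  ≈⟨ reassociate Cᵖ (dilate p geomS) (dilate p oneMinusX) R ⟩
    Cᵖ ⊛ ((dilate p geomS ⊛ dilate p oneMinusX) ⊛ R)  ≈⟨ ⊛-congˡ Cᵖ (≈-trans (⊛-congʳ R (dilate-geomS⊛oneMinusX p)) (⊛-identityˡ R)) ⟩
    Cᵖ ⊛ R                                            ≈⟨ ⊛-congʳ R (≈-sym C⊛φ0≈Cᵖ) ⟩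
    (oneMinusX ⊛ φ 0) ⊛ R                             ≈⟨ ⊛-assoc oneMinusX (φ 0) R ⟩
    oneMinusX ⊛ (φ 0 ⊛ R)                             ≈⟨ ⊛-congˡ oneMinusX (≈-sym (prodS-unfoldˡ K φ)) ⟩
    G (suc K)                                         ∎)
    where
    open ≈-Reasoning
    Cᵖ = powS oneMinusX p
    φ : ℕ → Series
    φ i = powS (dilate (p ^ i) oneMinusX) (p ∸ 1)
    R = prodS K (λ i → φ (suc i))
    C⊛φ0≈Cᵖ : oneMinusX ⊛ φ 0 ≈ Cᵖ
    C⊛φ0≈Cᵖ = ≈-trans (⊛-congˡ oneMinusX (powS-cong (p ∸ 1) (dilate-1 oneMinusX))) (powS-p oneMinusX)
    dilate-prodS-φ : dilate p (prodS K φ) ≈ R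
    dilate-prodS-φ = ≈-trans (dilate-prodS p K φ) (prodS-cong K λ i →
      ≈-trans (dilate-powS p (dilate (p ^ i) oneMinusX) (p ∸ 1))
              (powS-cong (p ∸ 1) (≈-trans (dilate-dilate p (p ^ i) {{p≢0}} {{pⁱ≢0 i}} oneMinusX)
                                          (≈-reflexive (cong (λ a → dilate a oneMinusX) (ℕ.*-comm (p ^ i) p))))))
    dilate-G : dilate p (G K) ≈ dilate p oneMinusX ⊛ R
    dilate-G = ≈-trans (dilate-⊛ p oneMinusX (prodS K φ)) (⊛-congˡ (dilate p oneMinusX) dilate-prodS-φ)
    reassociate : ∀ a b c r → (a ⊛ b) ⊛ (c ⊛ r) ≈ a ⊛ ((b ⊛ c) ⊛ r)
    reassociate = solve 4 (λ a b c r → (a :* b) :* (c :* r) := a :* ((b :* c) :* r)) ≈-refl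

  G-stable : ∀ {N K} j → N ≤ p ^ K → G (j + K) ≅ G K mod 0 below N
  G-stable zero    _     = ≅-refl
  G-stable {N} {K} (suc j) N≤pᴷ =
    ≅-trans (≅-resp (≈-sym (partialProduct-unfoldʳ oneMinusX (j + K))) (⊛-identityʳ (G (j + K)))
                    (≅-⊛ (≅-refl {f = G (j + K)}) factor≅1))
            (G-stable j N≤pᴷ)
    where
    factor≅1 : powS (dilate (p ^ (j + K)) oneMinusX) (p ∸ 1) ≅ oneS mod 0 below N
    factor≅1 = ≅-trans (≅-powS (p ∸ 1) (dilate-oneMinusX≅1 (j + K) (ℕ.≤-trans N≤pᴷ (ℕ.^-monoʳ-≤ p (ℕ.m≤n+m K j)))))
                       (≈⇒≅ (powS-oneS (p ∸ 1)))

  module _ {N : ℕ} {H : Series} (H≅1 : H ≅ oneS mod p below N) (m : ℕ) where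

    powS-≅-linear-ν : powS H m ≅ oneS ⊕ natS m ⊛ (H ⊖ oneS) mod p ^ suc (suc (ν p m)) below N
    powS-≅-linear-ν with p^ν∣ p m
    ... | ℕ.divides q m≡q*pᵛ = subst (λ k → powS H k ≅ oneS ⊕ natS k ⊛ (H ⊖ oneS) mod p ^ suc (suc (ν p m)) below N)
                                     (trans (ℕ.*-comm (p ^ ν p m) q) (sym m≡q*pᵛ))
                                     (powS-≅-linear-pˢ (prime∣triangle p-prime 3≤p) H≅1 (ν p m) q)

    powS-≅1-ν : powS H m ≅ oneS mod p ^ ν p m * p below N
    powS-≅1-ν = ⊖≅0⇒≅ (≅-linear⇒⊖≅0 (ν p m) m (p^ν∣ p m) powS-≅-linear-ν H≅1)

  module _ (m n : ℕ) where

    private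
      v = ν p (suc m)
      N = suc (suc n)
      N≤pᴺ : N ≤ p ^ N
      N≤pᴺ = ℕ.<⇒≤ (n<pⁿ (ℕ.≤-trans (s≤s (s≤s z≤n)) 3≤p) N)
      p^[v+2]∣ : ∀ {x} → + (p ^ suc (suc v)) ℤ∣.∣ x → + (p ^ (v + 2)) ∣ x
      p^[v+2]∣ {x} = ℤ∣.∣⇒∣ᵤ ∘ subst (λ e → + (p ^ e) ℤ∣.∣ x) (ℕ.+-comm 2 v)

    d[-m,n]≡-d[m,n] : + (p ^ (v + 2)) ∣ d p (- (+ suc m)) (suc n) ℤ.- (- d p (+ suc m) (suc n))
    d[-m,n]≡-d[m,n] =
      p^[v+2]∣ (subst (+ (p ^ suc (suc v)) ℤ∣.∣_) coefficient (ℤ∣.∣m⇒∣-m (divides-at product≅0 (suc n) ℕ.≤-refl)))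
      where
      Fᵐ Gᵐ : Series
      Fᵐ = powS (F N) (suc m)
      Gᵐ = powS (G N) (suc m)
      -- (Fᵐ - 1)(Gᵐ - 1) = 2 - Fᵐ - Gᵐ since Fᵐ Gᵐ = 1, and each factor is divisible by p^(v+1).
      product≈ : (Fᵐ ⊖ oneS) ⊛ (Gᵐ ⊖ oneS) ≈ (oneS ⊕ oneS) ⊖ (Fᵐ ⊕ Gᵐ)
      product≈ = ≈-trans (expand Fᵐ Gᵐ) (+-cong (+-cong Fᵐ⊛Gᵐ≈1 (≈-refl {oneS})) (≈-refl {⊝ (Fᵐ ⊕ Gᵐ)}))
        where
        Fᵐ⊛Gᵐ≈1 : Fᵐ ⊛ Gᵐ ≈ oneS
        Fᵐ⊛Gᵐ≈1 = ≈-trans (≈-sym (powS-distrib-⊛ (F N) (G N) (suc m))) (≈-trans (powS-cong (suc m) (F⊛G N)) (powS-oneS (suc m)))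
        expand : ∀ X Y → (X ⊖ oneS) ⊛ (Y ⊖ oneS) ≈ (X ⊛ Y ⊕ oneS) ⊖ (X ⊕ Y)
        expand = solve 2 (λ X Y → (X :- con (+ 1)) :* (Y :- con (+ 1)) := (X :* Y :+ con (+ 1)) :- (X :+ Y)) ≈-refl
      product≅0 : (oneS ⊕ oneS) ⊖ (Fᵐ ⊕ Gᵐ) ≅ zeroS mod p ^ suc (suc v) below N
      product≅0 = ≅-respˡ product≈ (≅-weaken (ℕ.divides (p ^ v) (square p (p ^ v)))
                    (≅0-⊛ (≅⇒⊖≅0 (powS-≅1-ν (F≅1 N N≤pᴺ) (suc m)))
                          (≅⇒⊖≅0 (powS-≅1-ν (G≅1 N N≤pᴺ) (suc m)))))
        where
        square : ∀ p x → x * p * (x * p) ≡ x * (p * (p * x))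
        square = solveℕ
      coefficient : - (((oneS ⊕ oneS) ⊖ (Fᵐ ⊕ Gᵐ)) (suc n) ℤ.- + 0) ≡ d p (- (+ suc m)) (suc n) ℤ.- (- d p (+ suc m) (suc n))
      coefficient = trans (rearrange (Fᵐ (suc n)) (Gᵐ (suc n)))
                          (sym (cong₂ (λ a b → a ℤ.- (- b)) (d[-m]≡Gᵐ m (suc n)) (d[m]≡Fᵐ (suc m) (suc n))))
        where
        rearrange : ∀ a b → - (((+ 0 ℤ.+ + 0) ℤ.- (a ℤ.+ b)) ℤ.- + 0) ≡ b ℤ.- (- a)
        rearrange = solve-∀

    d[-m,pn]≡d[-m,n] : + (p ^ (v + 2)) ∣ d p (- (+ suc m)) (p * suc n) ℤ.- d p (- (+ suc m)) (suc n)
    d[-m,pn]≡d[-m,n] = p^[v+2]∣ (subst₂ (λ a b → + (p ^ suc (suc v)) ℤ∣.∣ a ℤ.- b) (sym d-at-pn) (sym (d[-m]≡Gᵐ m (suc n)))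
                                  (divides-at step≅ (suc n) ℕ.≤-refl))
      where
      K = p * suc n
      H = powS (G K) (suc m)
      Wᵐ = powS w (suc m)
      -- G(K+1)ᵐ = wᵐ H(x^p), so its coefficient at p(n+1) only involves the coefficients of wᵐ at multiples of p.
      d-at-pn : d p (- (+ suc m)) K ≡ (H ⊛ compress p Wᵐ) (suc n)
      d-at-pn = begin
        d p (- (+ suc m)) K            ≡⟨ d[-m]≡Gᵐ m K ⟩
        powS (G (suc K)) (suc m) K     ≡⟨ coeff Gᵐ≈ K ⟩
        (Wᵐ ⊛ dilate p H) K            ≡⟨ coeff (⊛-comm Wᵐ (dilate p H)) K ⟩
        (dilate p H ⊛ Wᵐ) K            ≡⟨ cong (dilate p H ⊛ Wᵐ) (ℕ.*-comm p (suc n)) ⟩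
        (dilate p H ⊛ Wᵐ) (suc n * p)  ≡⟨ dilate-⊛-mult p H Wᵐ (suc n) ⟩
        (H ⊛ compress p Wᵐ) (suc n)    ∎
        where
        open ≡-Reasoning
        Gᵐ≈ : powS (G (suc K)) (suc m) ≈ Wᵐ ⊛ dilate p H
        Gᵐ≈ = ≈-trans (powS-cong (suc m) (G-step K))
                (≈-trans (powS-distrib-⊛ w (dilate p (G K)) (suc m)) (⊛-congˡ Wᵐ (≈-sym (dilate-powS p (G K) (suc m)))))
      compress-Wᵐ≅1 : compress p Wᵐ ≅ oneS mod p ^ suc (suc v) below N
      compress-Wᵐ≅1 = ≅-trans (≅-compress p (powS-≅-linear-ν w≅1 (suc m))) (≈⇒≅ (compress-linear p (suc m) w compress-w))
      N≤K : N ≤ K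
      N≤K = begin
        suc (suc n)    ≤⟨ s≤s (ℕ.m≤n+m (suc n) n) ⟩
        suc n + suc n  ≡⟨ cong (suc n ℕ.+_) (ℕ.+-identityʳ (suc n)) ⟨
        2 * suc n      ≤⟨ ℕ.*-monoˡ-≤ (suc n) (ℕ.≤-trans (s≤s (s≤s z≤n)) 3≤p) ⟩
        K              ∎
        where open ℕ.≤-Reasoning
      G-K≅ : G K ≅ G N mod 0 below N
      G-K≅ = subst (λ k → G k ≅ G N mod 0 below N) (ℕ.m∸n+n≡m N≤K) (G-stable (K ∸ N) N≤pᴺ)
      step≅ : H ⊛ compress p Wᵐ ≅ powS (G N) (suc m) mod p ^ suc (suc v) below N
      step≅ = ≅-trans (≅-⊛ (≅-refl {f = H}) compress-Wᵐ≅1)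
                (≅-trans (≈⇒≅ (⊛-identityʳ H)) (≅-weaken (_ ℕ.∣0) (≅-powS (suc m) G-K≅)))

theorem4p3 : (p : ℕ) → Prime p → 3 ≤ p → (m : ℕ) → 1 ≤ m → (n : ℕ) → 1 ≤ n →
    ((+ (p ^ (ν p m + 2))) ∣ (d p (- (+ m)) n ℤ.- (- d p (+ m) n)))
    × ((+ (p ^ (ν p m + 2))) ∣ (d p (- (+ m)) (p * n) ℤ.- d p (- (+ m)) n))
theorem4p3 p p-prime 3≤p (suc m) _ (suc n) _ = d[-m,n]≡-d[m,n] p-prime 3≤p m n , d[-m,pn]≡d[-m,n] p-prime 3≤p m n
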